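{- Let $G$ be a bicolored graph. Then $G\in\mathcal{T}$ if and only if each connected component of $G$ is either an rb-fence or an rb-clique-star.
   Context: A bicolored graph has each edge colored blue or red. $\mathcal{T}$ is the class of bicolored graphs that contain none of the following as an induced subgraph (with colors preserved): (a) a path on three vertices with two blue edges; (b) a path on three vertices with two red edges; (c) a triangle with two blue edges and one red edge; (d) a triangle with two red edges and one blue edge; (e) a path on four vertices whose consecutive edges are red, blue, red. (Equivalently to (a)–(d): the blue subgraph and the red subgraph are each disjoint unions of cliques.) An rb-fence is a graph whose vertex set is the disjoint union of two sets $X,Y$ with $|X|,|Y|\geq 2$, each inducing a clique all of whose edges are blue, and whose remaining edges are red and form a matching between $X$ and $Y$. An rb-clique-star is a graph consisting of one clique $X$ all of whose edges are red, together with at most $|X|$ pairwise vertex-disjoint cliques all of whose edges are blue, each of which intersects $X$ in exactly one vertex, and no further edges. -}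

module Defs where

open import Data.Nat using (ℕ; _≤_)
open import Data.Fin using (Fin; zero; suc)
open import Data.Fin.Subset using (Subset; _∈_; ∣_∣)
open import Data.Maybe using (Maybe; just; nothing)
open import Data.Product using (Σ; ∃; ∃-syntax; _×_)
open import Data.Sum using (_⊎_)
open import Relation.Nullary using (¬_)
open import Relation.Binary.PropositionalEquality using (_≡_; _≢_)
open import Relation.Binary.Construct.Closure.ReflexiveTransitive using (Star)
open import Function.Definitions using (Injective)
open import Function.Bundles using (_⇔_)

data Colour : Set where
  blue red : Colour

-- A (finite, simple) bicoloured graph on vertex set Fin n:
-- colour u v = nothing (no edge), just blue, or just red.
record BicoloredGraph (n : ℕ) : Set where
  field
    colour : Fin n → Fin n → Maybe Colour
    sym    : ∀ u v → colour u v ≡ colour v u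
    loopless : ∀ v → colour v v ≡ nothing
open BicoloredGraph public

ContainsInduced : ∀ {n m} → BicoloredGraph n → (Fin m → Fin m → Maybe Colour) → Set
ContainsInduced {n} {m} G H =
  Σ (Fin m → Fin n) λ f → Injective _≡_ _≡_ f × (∀ i j → colour G (f i) (f j) ≡ H i j)

P3 : Colour → Colour → Fin 3 → Fin 3 → Maybe Colour
P3 a b zero (suc zero) = just a
P3 a b (suc zero) zero = just a
P3 a b (suc zero) (suc (suc zero)) = just b
P3 a b (suc (suc zero)) (suc zero) = just b
P3 a b _ _ = nothing

Tri : Colour → Colour → Colour → Fin 3 → Fin 3 → Maybe Colour
Tri a b c zero (suc zero) = just a
Tri a b c (suc zero) zero = just a
Tri a b c (suc zero) (suc (suc zero)) = just b
Tri a b c (suc (suc zero)) (suc zero) = just b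
Tri a b c zero (suc (suc zero)) = just c
Tri a b c (suc (suc zero)) zero = just c
Tri a b c _ _ = nothing

P4rbr : Fin 4 → Fin 4 → Maybe Colour
P4rbr zero (suc zero) = just red
P4rbr (suc zero) zero = just red
P4rbr (suc zero) (suc (suc zero)) = just blue
P4rbr (suc (suc zero)) (suc zero) = just blue
P4rbr (suc (suc zero)) (suc (suc (suc zero))) = just red
P4rbr (suc (suc (suc zero))) (suc (suc zero)) = just red
P4rbr _ _ = nothing

InT : ∀ {n} → BicoloredGraph n → Set
InT G =
  ¬ ContainsInduced G (P3 blue blue) ×
  ¬ ContainsInduced G (P3 red red) ×
  ¬ ContainsInduced G (Tri blue blue red) ×
  ¬ ContainsInduced G (Tri red red blue) ×
  ¬ ContainsInduced G P4rbr

Adj : ∀ {n} → BicoloredGraph n → Fin n → Fin n → Set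
Adj G u v = colour G u v ≢ nothing

Reachable : ∀ {n} → BicoloredGraph n → Fin n → Fin n → Set
Reachable G = Star (Adj G)

IsComponent : ∀ {n} → BicoloredGraph n → Subset n → Set
IsComponent {n} G C = ∃[ v ] (∀ (u : Fin n) → (u ∈ C) ⇔ Reachable G v u)

IsRBFence : ∀ {n} → BicoloredGraph n → Subset n → Set
IsRBFence {n} G C = ∃[ X ] ∃[ Y ]
  ( (∀ u → (u ∈ C) ⇔ (u ∈ X ⊎ u ∈ Y))
  × (∀ u → ¬ (u ∈ X × u ∈ Y))
  × 2 ≤ ∣ X ∣ × 2 ≤ ∣ Y ∣
  × (∀ u v → u ∈ X → v ∈ X → u ≢ v → colour G u v ≡ just blue)
  × (∀ u v → u ∈ Y → v ∈ Y → u ≢ v → colour G u v ≡ just blue)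
  × (∀ u v → u ∈ X → v ∈ Y → (colour G u v ≡ nothing ⊎ colour G u v ≡ just red))
  × (∀ u v w → u ∈ X → v ∈ Y → w ∈ Y →
       colour G u v ≡ just red → colour G u w ≡ just red → v ≡ w)
  × (∀ u v w → u ∈ Y → v ∈ X → w ∈ X →
       colour G u v ≡ just red → colour G u w ≡ just red → v ≡ w))

IsRBCliqueStar : ∀ {n} → BicoloredGraph n → Subset n → Set
IsRBCliqueStar {n} G C = ∃[ X ] ∃[ k ] Σ (Fin k → Subset n) λ B →
  ( (∀ u → (u ∈ C) ⇔ (u ∈ X ⊎ ∃[ i ] (u ∈ B i)))
  × k ≤ ∣ X ∣
  × (∀ i j u → i ≢ j → ¬ (u ∈ B i × u ∈ B j))
  × (∀ i → ∃[ x ] (x ∈ X × x ∈ B i × (∀ y → y ∈ X → y ∈ B i → y ≡ x)))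
  × (∀ u v → u ∈ X → v ∈ X → u ≢ v → colour G u v ≡ just red)
  × (∀ i u v → u ∈ B i → v ∈ B i → u ≢ v → colour G u v ≡ just blue)
  × (∀ u v → u ∈ C → v ∈ C → colour G u v ≢ nothing →
       (u ∈ X × v ∈ X) ⊎ ∃[ i ] (u ∈ B i × v ∈ B i)))

module Submission where

-- Forbidding (a)–(d) makes "equal or joined by a κ-edge" an equivalence relation for
-- each colour κ, and forbidding (e) forces every red–blue–red path a b d e to be closed
-- by a blue edge ae.  If a component contains such a path, its red edges swap the blue
-- classes of b and a, so it is the fence on these two classes.  Otherwise no blue–red
-- path starts in the red class X of a suitably chosen vertex, and the component is X
-- with the blue classes of its vertices attached: a clique-star.  Conversely, fences and
-- clique-stars obey these transitivity and closure laws, and each forbidden pattern is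
-- connected, so it would break them inside a single component.

open import Defs renaming (sym to colour-sym)
open import Data.Bool.Base using (Bool; true; false; not)
open import Data.Bool.Properties using (T-≡)
open import Data.Fin using (Fin; zero; suc; #_)
open import Data.Fin.Properties using (any?; suc-injective) renaming (_≟_ to _≟ᶠ_)
open import Data.Fin.Subset using (Subset; _∈_; ∣_∣; ⁅_⁆; _⊆_; _⊂_)
open import Data.Fin.Subset.Properties using (_∈?_; ∣p∣≤n; p⊂q⇒∣p∣<∣q∣; x∈⁅x⁆; x∈⁅y⁆⇒x≡y; ∣⁅x⁆∣≡1)
open import Data.Maybe.Base using (Maybe; just; nothing)
open import Data.Maybe.Properties using (≡-dec; just-injective)
open import Data.Nat.Base using (ℕ; zero; suc; _≤_; _<_; s≤s; z≤n)
open import Data.Nat.Properties using (≤-refl; <-≤-trans; <-irrefl)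
open import Data.Product.Base using (∃-syntax; _×_; _,_; proj₁; proj₂; map₂)
open import Data.Sum.Base as Sum using (_⊎_; inj₁; inj₂)
open import Data.Vec.Base using (Vec; _∷_; []; lookup; tabulate; here; there)
open import Data.Vec.Properties using (lookup∘tabulate; []=⇒lookup; lookup⇒[]=)
open import Data.Vec.Relation.Unary.All using ([]; _∷_)
open import Data.Vec.Relation.Unary.AllPairs using ([]; _∷_)
open import Data.Vec.Relation.Unary.Unique.Propositional using (Unique)
open import Data.Vec.Relation.Unary.Unique.Propositional.Properties using (lookup-injective)
open import Function.Base using (_∘_)
open import Function.Bundles using (_⇔_; mk⇔; Equivalence)
open import Relation.Binary.Core using (Rel)
open import Relation.Binary.Definitions using (Decidable; DecidableEquality)
open import Relation.Binary.PropositionalEquality.Core using (_≡_; _≢_; refl; sym; trans; cong; subst)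
open import Relation.Binary.Construct.Closure.ReflexiveTransitive using (Star; ε; _◅_; _◅◅_; reverse)
open import Relation.Nullary.Decidable
  using (Dec; yes; no; isYes; isYes≗does; dec-true; decidable-stable; toWitness; ¬?; _×-dec_; _⊎-dec_)
open import Relation.Nullary.Negation using (¬_; contradiction)
open import Relation.Unary using (Pred) renaming (Decidable to Decidable₁)

open Equivalence using (to; from)

module _ {n ℓ} {P : Pred (Fin n) ℓ} (P? : Decidable₁ P) where

  subset : Subset n
  subset = tabulate (isYes ∘ P?)

  ∈-subset : ∀ {u} → u ∈ subset ⇔ P u
  ∈-subset {u} = mk⇔
    (λ u∈ → toWitness (from T-≡ (trans (sym (lookup∘tabulate _ u)) ([]=⇒lookup u∈))))
    (λ p → lookup⇒[]= u subset (trans (lookup∘tabulate _ u) (trans (isYes≗does (P? u)) (dec-true (P? u) p))))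

enum : ∀ {n} (p : Subset n) → Fin ∣ p ∣ → Fin n
enum (true ∷ p) zero = zero
enum (true ∷ p) (suc i) = suc (enum p i)
enum (false ∷ p) i = suc (enum p i)

enum-∈ : ∀ {n} (p : Subset n) i → enum p i ∈ p
enum-∈ (true ∷ p) zero = here
enum-∈ (true ∷ p) (suc i) = there (enum-∈ p i)
enum-∈ (false ∷ p) i = there (enum-∈ p i)

enum-injective : ∀ {n} (p : Subset n) {i j} → enum p i ≡ enum p j → i ≡ j
enum-injective (true ∷ p) {zero} {zero} _ = refl
enum-injective (true ∷ p) {suc i} {suc j} e = cong suc (enum-injective p (suc-injective e))
enum-injective (false ∷ p) e = enum-injective p (suc-injective e)

enum-surjective : ∀ {n} (p : Subset n) {x} → x ∈ p → ∃[ i ] enum p i ≡ x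
enum-surjective (true ∷ p) here = zero , refl
enum-surjective (true ∷ p) (there x∈p) with enum-surjective p x∈p
... | i , refl = suc i , refl
enum-surjective (false ∷ p) (there x∈p) with enum-surjective p x∈p
... | i , refl = i , refl

x≢y⇒2≤∣p∣ : ∀ {n} {p : Subset n} {x y} → x ∈ p → y ∈ p → x ≢ y → 2 ≤ ∣ p ∣
x≢y⇒2≤∣p∣ {p = p} {x} {y} x∈p y∈p x≢y = subst (_< ∣ p ∣) (∣⁅x⁆∣≡1 x) (p⊂q⇒∣p∣<∣q∣
  ( (λ z∈⁅x⁆ → subst (_∈ p) (sym (x∈⁅y⁆⇒x≡y x z∈⁅x⁆)) x∈p)
  , y , y∈p , λ y∈⁅x⁆ → x≢y (sym (x∈⁅y⁆⇒x≡y x y∈⁅x⁆))))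

module StarClosure {n ℓ} {R : Rel (Fin n) ℓ} (R? : Decidable R) where

  Closed : Subset n → Set ℓ
  Closed S = ∀ {x y} → x ∈ S → R x y → y ∈ S

  closed-Star : ∀ {S x y} → Closed S → x ∈ S → Star R x y → y ∈ S
  closed-Star S-closed x∈S ε = x∈S
  closed-Star S-closed x∈S (r ◅ rs) = closed-Star S-closed (S-closed x∈S r) rs

  step? : (S : Subset n) → Decidable₁ (λ u → u ∈ S ⊎ ∃[ w ] (w ∈ S × R w u))
  step? S u = u ∈? S ⊎-dec any? (λ w → w ∈? S ×-dec R? w u)

  step : Subset n → Subset n
  step S = subset (step? S)

  ⊆-step : ∀ {S} → S ⊆ step S
  ⊆-step {S} u∈S = from (∈-subset (step? S)) (inj₁ u∈S)

  closed⇒step⊆ : ∀ {S} → Closed S → step S ⊆ S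
  closed⇒step⊆ {S} S-closed u∈ with to (∈-subset (step? S)) u∈
  ... | inj₁ u∈S = u∈S
  ... | inj₂ (w , w∈S , r) = S-closed w∈S r

  step⊆⇒closed : ∀ {S} → step S ⊆ S → Closed (step S)
  step⊆⇒closed {S} step⊆S x∈ r = from (∈-subset (step? S)) (inj₂ (_ , step⊆S x∈ , r))

  step-closed-or-grows : ∀ S → Closed (step S) ⊎ S ⊂ step S
  step-closed-or-grows S with any? (λ x → x ∈? step S ×-dec ¬? (x ∈? S))
  ... | yes (x , x∈ , x∉S) = inj₂ (⊆-step , x , x∈ , x∉S)
  ... | no no-new =
    inj₁ (step⊆⇒closed λ {x} x∈ → decidable-stable (x ∈? S) λ x∉S → no-new (x , x∈ , x∉S))

  ball : Fin n → ℕ → Subset n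
  ball v zero = ⁅ v ⁆
  ball v (suc k) = step (ball v k)

  ball-closed-or-large : ∀ v k → Closed (ball v k) ⊎ k < ∣ ball v k ∣
  ball-closed-or-large v zero = inj₂ (subst (0 <_) (sym (∣⁅x⁆∣≡1 v)) (s≤s z≤n))
  ball-closed-or-large v (suc k) with ball-closed-or-large v k | step-closed-or-grows (ball v k)
  ... | _ | inj₁ closed = inj₁ closed
  ... | inj₁ closed | inj₂ _ = inj₁ (step⊆⇒closed (closed⇒step⊆ closed))
  ... | inj₂ large | inj₂ grows = inj₂ (<-≤-trans (s≤s large) (p⊂q⇒∣p∣<∣q∣ grows))

  ball-sound : ∀ {v} k {u} → u ∈ ball v k → Star R v u
  ball-sound {v} zero u∈ with x∈⁅y⁆⇒x≡y v u∈
  ... | refl = ε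
  ball-sound {v} (suc k) u∈ with to (∈-subset (step? (ball v k))) u∈
  ... | inj₁ u∈′ = ball-sound k u∈′
  ... | inj₂ (w , w∈ , r) = ball-sound k w∈ ◅◅ (r ◅ ε)

  ∈-ball : ∀ v k → v ∈ ball v k
  ∈-ball v zero = x∈⁅x⁆ v
  ∈-ball v (suc k) = ⊆-step (∈-ball v k)

  reachable : Fin n → Subset n
  reachable v = ball v n

  reachable-closed : ∀ v → Closed (reachable v)
  reachable-closed v with ball-closed-or-large v n
  ... | inj₁ closed = closed
  ... | inj₂ large = contradiction (<-≤-trans large (∣p∣≤n (reachable v))) (<-irrefl refl)

  ∈-reachable : ∀ v {u} → u ∈ reachable v ⇔ Star R v u
  ∈-reachable v = mk⇔ (ball-sound n) (closed-Star (reachable-closed v) (∈-ball v n))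

_≟ᶜ_ : DecidableEquality Colour
blue ≟ᶜ blue = yes refl
blue ≟ᶜ red = no λ ()
red ≟ᶜ blue = no λ ()
red ≟ᶜ red = yes refl

_≟ᵐ_ : DecidableEquality (Maybe Colour)
_≟ᵐ_ = ≡-dec _≟ᶜ_

other : Colour → Colour
other blue = red
other red = blue

other≢ : ∀ κ → other κ ≢ κ
other≢ blue ()
other≢ red ()

≢⇒other : ∀ {κ κ′} → κ′ ≢ κ → κ′ ≡ other κ
≢⇒other {blue} {blue} κ′≢κ = contradiction refl κ′≢κ
≢⇒other {blue} {red} _ = refl
≢⇒other {red} {blue} _ = refl
≢⇒other {red} {red} κ′≢κ = contradiction refl κ′≢κ

module Basics {n} (G : BicoloredGraph n) where

  infix 4 _—[_]—_ _≁_ _≈[_]_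

  _—[_]—_ : Fin n → Colour → Fin n → Set
  u —[ κ ]— w = colour G u w ≡ just κ

  _≁_ : Fin n → Fin n → Set
  u ≁ w = colour G u w ≡ nothing

  private variable
    κ κ′ κ″ : Colour
    m : Maybe Colour
    a b d e u v w x y z : Fin n

  colour-swap : colour G u w ≡ m → colour G w u ≡ m
  colour-swap {u} {w} = trans (colour-sym G w u)

  edge? : ∀ κ u w → Dec (u —[ κ ]— w)
  edge? κ u w = colour G u w ≟ᵐ just κ

  edge⇒≢ : u —[ κ ]— w → u ≢ w
  edge⇒≢ {u} e refl with () ← trans (sym (loopless G u)) e

  edge⇒Adj : u —[ κ ]— w → Adj G u w
  edge⇒Adj e u≁w with () ← trans (sym e) u≁w

  edge-colour-unique : u —[ κ ]— w → u —[ κ′ ]— w → κ ≡ κ′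
  edge-colour-unique e e′ = just-injective (trans (sym e) e′)

  blue-red-clash : u —[ blue ]— w → ¬ u —[ red ]— w
  blue-red-clash e e′ with () ← edge-colour-unique e e′

  embedding : ∀ {m} {H : Fin m → Fin m → Maybe Colour} (vs : Vec (Fin n) m) → Unique vs →
              (∀ i j → colour G (lookup vs i) (lookup vs j) ≡ H i j) → ContainsInduced G H
  embedding vs vs-unique table = lookup vs , lookup-injective vs-unique _ _ , table

  P3-embedding : u —[ κ ]— v → v —[ κ′ ]— w → u ≁ w → u ≢ w → ContainsInduced G (P3 κ κ′)
  P3-embedding {u} {v = v} {w = w} uv vw uw u≢w = embedding (u ∷ v ∷ w ∷ [])
    ((edge⇒≢ uv ∷ u≢w ∷ []) ∷ (edge⇒≢ vw ∷ []) ∷ [] ∷ []) table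
    where
    table : ∀ i j → colour G (lookup (u ∷ v ∷ w ∷ []) i) (lookup (u ∷ v ∷ w ∷ []) j) ≡ P3 _ _ i j
    table zero zero = loopless G u
    table zero (suc zero) = uv
    table zero (suc (suc zero)) = uw
    table (suc zero) zero = colour-swap uv
    table (suc zero) (suc zero) = loopless G v
    table (suc zero) (suc (suc zero)) = vw
    table (suc (suc zero)) zero = colour-swap uw
    table (suc (suc zero)) (suc zero) = colour-swap vw
    table (suc (suc zero)) (suc (suc zero)) = loopless G w

  Tri-embedding : u —[ κ ]— v → v —[ κ′ ]— w → u —[ κ″ ]— w → ContainsInduced G (Tri κ κ′ κ″)
  Tri-embedding {u} {v = v} {w = w} uv vw uw = embedding (u ∷ v ∷ w ∷ [])
    ((edge⇒≢ uv ∷ edge⇒≢ uw ∷ []) ∷ (edge⇒≢ vw ∷ []) ∷ [] ∷ []) table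
    where
    table : ∀ i j → colour G (lookup (u ∷ v ∷ w ∷ []) i) (lookup (u ∷ v ∷ w ∷ []) j) ≡ Tri _ _ _ i j
    table zero zero = loopless G u
    table zero (suc zero) = uv
    table zero (suc (suc zero)) = uw
    table (suc zero) zero = colour-swap uv
    table (suc zero) (suc zero) = loopless G v
    table (suc zero) (suc (suc zero)) = vw
    table (suc (suc zero)) zero = colour-swap uw
    table (suc (suc zero)) (suc zero) = colour-swap vw
    table (suc (suc zero)) (suc (suc zero)) = loopless G w

  P4-embedding : a —[ red ]— b → b —[ blue ]— d → d —[ red ]— e → a ≁ d → b ≁ e → a ≁ e →
                 a ≢ d → b ≢ e → a ≢ e → ContainsInduced G P4rbr
  P4-embedding {a} {b} {d} {e} ab bd de ad be ae a≢d b≢e a≢e = embedding (a ∷ b ∷ d ∷ e ∷ [])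
    ((edge⇒≢ ab ∷ a≢d ∷ a≢e ∷ []) ∷ (edge⇒≢ bd ∷ b≢e ∷ []) ∷ (edge⇒≢ de ∷ []) ∷ [] ∷ []) table
    where
    table : ∀ i j → colour G (lookup (a ∷ b ∷ d ∷ e ∷ []) i) (lookup (a ∷ b ∷ d ∷ e ∷ []) j) ≡ P4rbr i j
    table zero zero = loopless G a
    table zero (suc zero) = ab
    table zero (suc (suc zero)) = ad
    table zero (suc (suc (suc zero))) = ae
    table (suc zero) zero = colour-swap ab
    table (suc zero) (suc zero) = loopless G b
    table (suc zero) (suc (suc zero)) = bd
    table (suc zero) (suc (suc (suc zero))) = be
    table (suc (suc zero)) zero = colour-swap ad
    table (suc (suc zero)) (suc zero) = colour-swap bd
    table (suc (suc zero)) (suc (suc zero)) = loopless G d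
    table (suc (suc zero)) (suc (suc (suc zero))) = de
    table (suc (suc (suc zero))) zero = colour-swap ae
    table (suc (suc (suc zero))) (suc zero) = colour-swap be
    table (suc (suc (suc zero))) (suc (suc zero)) = colour-swap de
    table (suc (suc (suc zero))) (suc (suc (suc zero))) = loopless G e

  _≈[_]_ : Fin n → Colour → Fin n → Set
  x ≈[ κ ] y = x ≡ y ⊎ x —[ κ ]— y

  ≈-sym : x ≈[ κ ] y → y ≈[ κ ] x
  ≈-sym (inj₁ refl) = inj₁ refl
  ≈-sym (inj₂ e) = inj₂ (colour-swap e)

  ≈-blue-red⇒≡ : x ≈[ blue ] y → x ≈[ red ] y → x ≡ y
  ≈-blue-red⇒≡ (inj₁ x≡y) _ = x≡y
  ≈-blue-red⇒≡ _ (inj₁ x≡y) = x≡y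
  ≈-blue-red⇒≡ (inj₂ e) (inj₂ e′) = contradiction e′ (blue-red-clash e)

  class : Colour → Fin n → Subset n
  class κ x = subset (λ y → x ≟ᶠ y ⊎-dec edge? κ x y)

  ∈-class : y ∈ class κ x ⇔ x ≈[ κ ] y
  ∈-class {κ = κ} {x} = ∈-subset (λ y → x ≟ᶠ y ⊎-dec edge? κ x y)

  adj? : Decidable (Adj G)
  adj? u w = ¬? (colour G u w ≟ᵐ nothing)

  Adj-sym : Adj G u w → Adj G w u
  Adj-sym u~w w≁u = u~w (colour-swap w≁u)

  Reachable-sym : Reachable G u w → Reachable G w u
  Reachable-sym = reverse Adj-sym

  ≈⇒Reachable : x ≈[ κ ] y → Reachable G x y
  ≈⇒Reachable (inj₁ refl) = ε
  ≈⇒Reachable (inj₂ e) = edge⇒Adj e ◅ ε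

  Preserved : (Fin n → Set) → Set
  Preserved S = ∀ {x y} → S x → Adj G x y → S y

  preserved-along : ∀ {S} → Preserved S → Reachable G x y → S x → S y
  preserved-along S-preserved ε s = s
  preserved-along S-preserved (x~ ◅ rs) s = preserved-along S-preserved rs (S-preserved s x~)

  module Component {C} (C-component : IsComponent G C) where

    private
      iff : ∀ u → u ∈ C ⇔ Reachable G (proj₁ C-component) u
      iff = proj₂ C-component

    reach-closed : u ∈ C → Reachable G u w → w ∈ C
    reach-closed {u} {w} u∈C rs = from (iff w) (to (iff u) u∈C ◅◅ rs)

    connected : u ∈ C → w ∈ C → Reachable G u w
    connected {u} {w} u∈C w∈C = Reachable-sym (to (iff u) u∈C) ◅◅ to (iff w) w∈C

    spread : ∀ {S} → Preserved S → b ∈ C → S b → u ∈ C → S u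
    spread S-preserved b∈C s u∈C = preserved-along S-preserved (connected b∈C u∈C) s

module Forward {n} (G : BicoloredGraph n) (G∈𝒯 : InT G) where

  open Basics G

  private variable
    κ : Colour
    a b d e u v w x y z : Fin n
    C : Subset n

  no-P3 : ∀ κ → ¬ ContainsInduced G (P3 κ κ)
  no-P3 blue = proj₁ G∈𝒯
  no-P3 red = proj₁ (proj₂ G∈𝒯)

  no-Tri : ∀ κ → ¬ ContainsInduced G (Tri κ κ (other κ))
  no-Tri blue = proj₁ (proj₂ (proj₂ G∈𝒯))
  no-Tri red = proj₁ (proj₂ (proj₂ (proj₂ G∈𝒯)))

  no-P4 : ¬ ContainsInduced G P4rbr
  no-P4 = proj₂ (proj₂ (proj₂ (proj₂ G∈𝒯)))

  mono-trans : u —[ κ ]— v → v —[ κ ]— w → u ≢ w → u —[ κ ]— w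
  mono-trans {u} {κ} {w = w} uv vw u≢w with colour G u w in uw
  ... | nothing = contradiction (P3-embedding uv vw uw u≢w) (no-P3 κ)
  ... | just κ′ with κ′ ≟ᶜ κ
  ...   | yes refl = refl
  ...   | no κ′≢κ =
    contradiction (Tri-embedding uv vw (trans uw (cong just (≢⇒other κ′≢κ)))) (no-Tri κ)

  ≈-trans : x ≈[ κ ] y → y ≈[ κ ] z → x ≈[ κ ] z
  ≈-trans (inj₁ refl) yz = yz
  ≈-trans xy (inj₁ refl) = xy
  ≈-trans {x} {z = z} (inj₂ xy) (inj₂ yz) with x ≟ᶠ z
  ... | yes x≡z = inj₁ x≡z
  ... | no x≢z = inj₂ (mono-trans xy yz x≢z)

  ≈⇒edge : x ≈[ κ ] u → x ≈[ κ ] w → u ≢ w → u —[ κ ]— w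
  ≈⇒edge xu xw u≢w with ≈-trans (≈-sym xu) xw
  ... | inj₁ u≡w = contradiction u≡w u≢w
  ... | inj₂ uw = uw

  red-blue-distinct : a —[ red ]— b → b —[ blue ]— d → a ≢ d
  red-blue-distinct ab bd refl = blue-red-clash (colour-swap bd) ab

  red-blue-nonadjacent : a —[ red ]— b → b —[ blue ]— d → a ≁ d
  red-blue-nonadjacent {a} {d = d} ab bd with colour G a d in ad
  ... | nothing = refl
  ... | just red = contradiction (mono-trans (colour-swap ab) ad (edge⇒≢ bd)) (blue-red-clash bd)
  ... | just blue =
    contradiction (colour-swap ab) (blue-red-clash (mono-trans bd (colour-swap ad) (edge⇒≢ (colour-swap ab))))

  red-blue-red-closes : a —[ red ]— b → b —[ blue ]— d → d —[ red ]— e → a —[ blue ]— e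
  red-blue-red-closes {a} {b} {d} {e} ab bd de = closes (colour G a e) refl
    where
    a≁d : a ≁ d
    a≁d = red-blue-nonadjacent ab bd
    a≢d : a ≢ d
    a≢d = red-blue-distinct ab bd
    b≁e : b ≁ e
    b≁e = colour-swap (red-blue-nonadjacent (colour-swap de) (colour-swap bd))
    b≢e : b ≢ e
    b≢e = red-blue-distinct (colour-swap de) (colour-swap bd) ∘ sym
    a≢e : a ≢ e
    a≢e refl = blue-red-clash bd (mono-trans (colour-swap ab) (colour-swap de) (edge⇒≢ bd))

    closes : ∀ m → colour G a e ≡ m → a —[ blue ]— e
    closes nothing ae = contradiction (P4-embedding ab bd de a≁d b≁e ae a≢d b≢e a≢e) no-P4
    closes (just blue) ae = ae
    closes (just red) ae = contradiction a≁d (edge⇒Adj (mono-trans ae (colour-swap de) a≢d))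

  class-clique : u ∈ class κ x → w ∈ class κ x → u ≢ w → u —[ κ ]— w
  class-clique u∈ w∈ = ≈⇒edge (to ∈-class u∈) (to ∈-class w∈)

  class-matching : v ∈ class blue x → w ∈ class blue x → u —[ red ]— v → u —[ red ]— w → v ≡ w
  class-matching {v} {w = w} v∈ w∈ uv uw with v ≟ᶠ w
  ... | yes v≡w = v≡w
  ... | no v≢w = contradiction (mono-trans (colour-swap uv) uw v≢w) (blue-red-clash (class-clique v∈ w∈ v≢w))

  red-neighbour-of-blue-class : a —[ red ]— b → b —[ blue ]— d → d —[ red ]— e →
                                b ≈[ blue ] x → x —[ red ]— y → a ≈[ blue ] y
  red-neighbour-of-blue-class {a} {e = e} {y = y} ab bd de (inj₁ refl) by with a ≟ᶠ y
  ... | yes a≡y = inj₁ a≡y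
  ... | no a≢y = contradiction (mono-trans ab by a≢y) (blue-red-clash (mono-trans ae (colour-swap ye) a≢y))
    where
    ae : a —[ blue ]— e
    ae = red-blue-red-closes ab bd de
    ye : y —[ blue ]— e
    ye = red-blue-red-closes (colour-swap by) bd de
  red-neighbour-of-blue-class ab bd de (inj₂ bx) xy =
    inj₂ (colour-swap (red-blue-red-closes (colour-swap xy) (colour-swap bx) (colour-swap ab)))

  red-blue-red-fence : IsComponent G C → b ∈ C →
                       a —[ red ]— b → b —[ blue ]— d → d —[ red ]— e → IsRBFence G C
  red-blue-red-fence {C} {b} {a} {d} {e} C-component b∈C ab bd de =
    class blue b , class blue a , partition , (λ _ → disjoint) ,
    x≢y⇒2≤∣p∣ (from ∈-class (inj₁ refl)) (from ∈-class (inj₂ bd)) (edge⇒≢ bd) ,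
    x≢y⇒2≤∣p∣ (from ∈-class (inj₁ refl)) (from ∈-class (inj₂ ae)) (edge⇒≢ ae) ,
    (λ _ _ → class-clique) , (λ _ _ → class-clique) , cross ,
    (λ _ _ _ _ → class-matching) , (λ _ _ _ _ → class-matching)
    where
    open Component C-component

    ae : a —[ blue ]— e
    ae = red-blue-red-closes ab bd de

    Side : Fin n → Set
    Side u = b ≈[ blue ] u ⊎ a ≈[ blue ] u

    side-preserved : Preserved Side
    side-preserved {x} {y} side x~y with colour G x y in xy | side
    ... | nothing | _ = contradiction refl x~y
    ... | just blue | inj₁ bx = inj₁ (≈-trans bx (inj₂ xy))
    ... | just blue | inj₂ ax = inj₂ (≈-trans ax (inj₂ xy))
    ... | just red | inj₁ bx = inj₂ (red-neighbour-of-blue-class ab bd de bx xy)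
    ... | just red | inj₂ ax = inj₁ (red-neighbour-of-blue-class (colour-swap ab) ae (colour-swap de) ax xy)

    partition : ∀ u → u ∈ C ⇔ (u ∈ class blue b ⊎ u ∈ class blue a)
    partition u = mk⇔
      (λ u∈C → Sum.map (from ∈-class) (from ∈-class) (spread side-preserved b∈C (inj₁ (inj₁ refl)) u∈C))
      λ { (inj₁ u∈) → reach-closed b∈C (≈⇒Reachable (to ∈-class u∈))
        ; (inj₂ u∈) → reach-closed b∈C (edge⇒Adj (colour-swap ab) ◅ ≈⇒Reachable (to ∈-class u∈)) }

    disjoint : ¬ (u ∈ class blue b × u ∈ class blue a)
    disjoint (u∈X , u∈Y) with ≈-trans (to ∈-class u∈X) (≈-sym (to ∈-class u∈Y))
    ... | inj₁ b≡a = edge⇒≢ ab (sym b≡a)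
    ... | inj₂ ba = blue-red-clash ba (colour-swap ab)

    cross : ∀ u w → u ∈ class blue b → w ∈ class blue a → u ≁ w ⊎ u —[ red ]— w
    cross u w u∈X w∈Y with colour G u w in uw
    ... | nothing = inj₁ refl
    ... | just red = inj₂ refl
    ... | just blue = contradiction (from ∈-class (≈-trans (to ∈-class u∈X) (inj₂ uw)) , w∈Y) disjoint

  clique-star : ∀ {u₀} → IsComponent G C → u₀ ∈ C →
                (∀ {x y z} → u₀ ≈[ red ] x → x —[ blue ]— y → ¬ y —[ red ]— z) → IsRBCliqueStar G C
  clique-star {C} {u₀} C-component u₀∈C no-red-after-blue =
    X , ∣ X ∣ , B , partition , ≤-refl , disjoint , meets-X-once ,
    (λ _ _ → class-clique) , (λ _ _ _ → class-clique) , no-other-edges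
    where
    open Component C-component

    X : Subset n
    X = class red u₀

    centre : Fin ∣ X ∣ → Fin n
    centre = enum X

    B : Fin ∣ X ∣ → Subset n
    B i = class blue (centre i)

    Attached : Fin n → Set
    Attached u = ∃[ x ] (u₀ ≈[ red ] x × x ≈[ blue ] u)

    attached-preserved : Preserved Attached
    attached-preserved {u} {w} (x , u₀x , xu) u~w with colour G u w in uw | xu
    ... | nothing | _ = contradiction refl u~w
    ... | just blue | _ = x , u₀x , ≈-trans xu (inj₂ uw)
    ... | just red | inj₁ refl = w , ≈-trans u₀x (inj₂ uw) , inj₁ refl
    ... | just red | inj₂ xu′ = contradiction uw (no-red-after-blue u₀x xu′)

    attached-∈ : Attached u → u ∈ C
    attached-∈ (x , u₀x , xu) = reach-closed u₀∈C (≈⇒Reachable u₀x ◅◅ ≈⇒Reachable xu)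

    ∈-attached : u ∈ C → Attached u
    ∈-attached = spread attached-preserved u₀∈C (u₀ , inj₁ refl , inj₁ refl)

    common-blue-class : u₀ ≈[ red ] x → x ≈[ blue ] u → x ≈[ blue ] w → ∃[ i ] (u ∈ B i × w ∈ B i)
    common-blue-class u₀x xu xw with enum-surjective X (from ∈-class u₀x)
    ... | i , refl = i , from ∈-class xu , from ∈-class xw

    u₀≈centre : ∀ i → u₀ ≈[ red ] centre i
    u₀≈centre i = to ∈-class (enum-∈ X i)

    partition : ∀ u → u ∈ C ⇔ (u ∈ X ⊎ ∃[ i ] u ∈ B i)
    partition u = mk⇔
      (λ u∈C → let (x , u₀x , xu) = ∈-attached u∈C in
               inj₂ (map₂ proj₁ (common-blue-class u₀x xu xu)))
      λ { (inj₁ u∈X) → attached-∈ (u , to ∈-class u∈X , inj₁ refl)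
        ; (inj₂ (i , u∈B)) → attached-∈ (centre i , u₀≈centre i , to ∈-class u∈B) }

    disjoint : ∀ i j u → i ≢ j → ¬ (u ∈ B i × u ∈ B j)
    disjoint i j u i≢j (u∈Bi , u∈Bj) = i≢j (enum-injective X (≈-blue-red⇒≡
      (≈-trans (to ∈-class u∈Bi) (≈-sym (to ∈-class u∈Bj)))
      (≈-trans (≈-sym (u₀≈centre i)) (u₀≈centre j))))

    meets-X-once : ∀ i → ∃[ x ] (x ∈ X × x ∈ B i × (∀ y → y ∈ X → y ∈ B i → y ≡ x))
    meets-X-once i = centre i , enum-∈ X i , from ∈-class (inj₁ refl) ,
      λ y y∈X y∈Bi →
        sym (≈-blue-red⇒≡ (to ∈-class y∈Bi) (≈-trans (≈-sym (u₀≈centre i)) (to ∈-class y∈X)))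

    no-other-edges : ∀ u w → u ∈ C → w ∈ C → Adj G u w → (u ∈ X × w ∈ X) ⊎ ∃[ i ] (u ∈ B i × w ∈ B i)
    no-other-edges u w u∈C _ u~w with colour G u w in uw | ∈-attached u∈C
    ... | nothing | _ = contradiction refl u~w
    ... | just blue | x , u₀x , xu = inj₂ (common-blue-class u₀x xu (≈-trans xu (inj₂ uw)))
    ... | just red | x , u₀x , inj₁ refl =
      inj₁ (from ∈-class u₀x , from ∈-class (≈-trans u₀x (inj₂ uw)))
    ... | just red | x , u₀x , inj₂ xu = contradiction uw (no-red-after-blue u₀x xu)

  red-blue-red-path? : ∀ C → Dec (∃[ b ] (b ∈ C × ∃[ a ] ∃[ d ] ∃[ e ]
                                 (a —[ red ]— b × b —[ blue ]— d × d —[ red ]— e)))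
  red-blue-red-path? C = any? λ b → b ∈? C ×-dec any? λ a → any? λ d → any? λ e →
    edge? red a b ×-dec edge? blue b d ×-dec edge? red d e

  red-edge? : ∀ C → Dec (∃[ u ] (u ∈ C × ∃[ w ] u —[ red ]— w))
  red-edge? C = any? λ u → u ∈? C ×-dec any? λ w → edge? red u w

  component-shape : IsComponent G C → IsRBFence G C ⊎ IsRBCliqueStar G C
  component-shape {C} C-component@(v , _) with red-blue-red-path? C
  ... | yes (b , b∈C , a , d , e , ab , bd , de) = inj₁ (red-blue-red-fence C-component b∈C ab bd de)
  ... | no no-path with red-edge? C
  ...   | yes (u₀ , u₀∈C , w₀ , u₀w₀) = inj₂ (clique-star C-component u₀∈C no-red-after-blue)
    where
    open Component C-component
    no-red-after-blue : u₀ ≈[ red ] x → x —[ blue ]— y → ¬ y —[ red ]— z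
    no-red-after-blue (inj₁ refl) xy yz = no-path (u₀ , u₀∈C , w₀ , _ , _ , colour-swap u₀w₀ , xy , yz)
    no-red-after-blue (inj₂ u₀x) xy yz =
      no-path (_ , reach-closed u₀∈C (edge⇒Adj u₀x ◅ ε) , u₀ , _ , _ , u₀x , xy , yz)
  ...   | no no-red = inj₂ (clique-star C-component v∈C no-red-after-blue)
    where
    open Component C-component
    v∈C : v ∈ C
    v∈C = from (proj₂ C-component v) ε
    no-red-after-blue : v ≈[ red ] x → x —[ blue ]— y → ¬ y —[ red ]— z
    no-red-after-blue vx xy yz =
      no-red (_ , reach-closed v∈C (≈⇒Reachable vx ◅◅ edge⇒Adj xy ◅ ε) , _ , yz)

module Backward {n} (G : BicoloredGraph n) where

  open Basics G

  private variable
    κ : Colour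
    a b d e u v w : Fin n
    C : Subset n

  record Lawful (C : Subset n) : Set where
    field
      mono-trans : u ∈ C → v ∈ C → w ∈ C → u —[ κ ]— v → v —[ κ ]— w → u ≢ w → u —[ κ ]— w
      red-blue-red-adjacent : a ∈ C → b ∈ C → d ∈ C → e ∈ C →
                              a —[ red ]— b → b —[ blue ]— d → d —[ red ]— e → a ≢ e → Adj G a e

  fence-lawful : IsRBFence G C → Lawful C
  fence-lawful {C} (X , Y , partition , disjoint , _ , _ , X-clique , Y-clique , cross , X-matching , Y-matching) =
    record { mono-trans = mono-trans ; red-blue-red-adjacent = red-blue-red-adjacent }
    where
    part : Bool → Subset n
    part true = X
    part false = Y

    locate : u ∈ C → ∃[ s ] u ∈ part s
    locate {u} u∈C with to (partition u) u∈C
    ... | inj₁ u∈X = true , u∈X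
    ... | inj₂ u∈Y = false , u∈Y

    relative : ∀ s → w ∈ C → w ∈ part s ⊎ w ∈ part (not s)
    relative true w∈C = to (partition _) w∈C
    relative false w∈C = Sum.swap (to (partition _) w∈C)

    part-clique : ∀ s → u ∈ part s → w ∈ part s → u ≢ w → u —[ blue ]— w
    part-clique true = X-clique _ _
    part-clique false = Y-clique _ _

    part-cross : ∀ s → u ∈ part s → w ∈ part (not s) → ¬ u —[ blue ]— w
    part-cross true u∈X w∈Y uw with cross _ _ u∈X w∈Y
    ... | inj₁ u≁w = edge⇒Adj uw u≁w
    ... | inj₂ uw′ = blue-red-clash uw uw′
    part-cross false u∈Y w∈X uw = part-cross true w∈X u∈Y (colour-swap uw)

    part-matching : ∀ s → u ∈ part s → v ∈ part (not s) → w ∈ part (not s) →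
                    u —[ red ]— v → u —[ red ]— w → v ≡ w
    part-matching true = X-matching _ _ _
    part-matching false = Y-matching _ _ _

    blue-same-part : ∀ s → u ∈ part s → w ∈ C → u —[ blue ]— w → w ∈ part s
    blue-same-part s u∈ w∈C uw with relative s w∈C
    ... | inj₁ w∈ = w∈
    ... | inj₂ w∈ = contradiction uw (part-cross s u∈ w∈)

    red-other-part : ∀ s → u ∈ part s → w ∈ C → u —[ red ]— w → w ∈ part (not s)
    red-other-part s u∈ w∈C uw with relative s w∈C
    ... | inj₁ w∈ = contradiction uw (blue-red-clash (part-clique s u∈ w∈ (edge⇒≢ uw)))
    ... | inj₂ w∈ = w∈

    mono-trans : u ∈ C → v ∈ C → w ∈ C → u —[ κ ]— v → v —[ κ ]— w → u ≢ w → u —[ κ ]— w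
    mono-trans {κ = blue} u∈C v∈C w∈C uv vw u≢w =
      let (s , u∈) = locate u∈C in
      part-clique s u∈ (blue-same-part s (blue-same-part s u∈ v∈C uv) w∈C vw) u≢w
    mono-trans {κ = red} u∈C v∈C w∈C uv vw u≢w =
      let (s , v∈) = locate v∈C in
      contradiction (part-matching s v∈ (red-other-part s v∈ u∈C (colour-swap uv))
                                        (red-other-part s v∈ w∈C vw) (colour-swap uv) vw) u≢w

    red-blue-red-adjacent : a ∈ C → b ∈ C → d ∈ C → e ∈ C →
                            a —[ red ]— b → b —[ blue ]— d → d —[ red ]— e → a ≢ e → Adj G a e
    red-blue-red-adjacent a∈C b∈C d∈C e∈C ab bd de a≢e =
      let (s , b∈) = locate b∈C in
      edge⇒Adj (part-clique (not s) (red-other-part s b∈ a∈C (colour-swap ab))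
                                    (red-other-part s (blue-same-part s b∈ d∈C bd) e∈C de) a≢e)

  star-lawful : IsRBCliqueStar G C → Lawful C
  star-lawful {C} (X , k , B , _ , _ , disjoint , meets-X-once , X-clique , B-clique , no-other-edges) =
    record { mono-trans = mono-trans ; red-blue-red-adjacent = red-blue-red-adjacent }
    where
    blue-edge⇒same-B : u ∈ C → w ∈ C → u —[ blue ]— w → ∃[ i ] (u ∈ B i × w ∈ B i)
    blue-edge⇒same-B u∈C w∈C uw with no-other-edges _ _ u∈C w∈C (edge⇒Adj uw)
    ... | inj₁ (u∈X , w∈X) = contradiction (X-clique _ _ u∈X w∈X (edge⇒≢ uw)) (blue-red-clash uw)
    ... | inj₂ blob = blob

    red-edge⇒both-in-X : u ∈ C → w ∈ C → u —[ red ]— w → u ∈ X × w ∈ X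
    red-edge⇒both-in-X u∈C w∈C uw with no-other-edges _ _ u∈C w∈C (edge⇒Adj uw)
    ... | inj₁ both = both
    ... | inj₂ (i , u∈ , w∈) = contradiction uw (blue-red-clash (B-clique i _ _ u∈ w∈ (edge⇒≢ uw)))

    mono-trans : u ∈ C → v ∈ C → w ∈ C → u —[ κ ]— v → v —[ κ ]— w → u ≢ w → u —[ κ ]— w
    mono-trans {κ = blue} u∈C v∈C w∈C uv vw u≢w
      with blue-edge⇒same-B u∈C v∈C uv | blue-edge⇒same-B v∈C w∈C vw
    ... | i , u∈ , v∈ | j , v∈′ , w∈ with i ≟ᶠ j
    ...   | yes refl = B-clique i _ _ u∈ w∈ u≢w
    ...   | no i≢j = contradiction (v∈ , v∈′) (disjoint i j _ i≢j)
    mono-trans {κ = red} u∈C v∈C w∈C uv vw =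
      X-clique _ _ (proj₁ (red-edge⇒both-in-X u∈C v∈C uv)) (proj₂ (red-edge⇒both-in-X v∈C w∈C vw))

    red-blue-red-adjacent : a ∈ C → b ∈ C → d ∈ C → e ∈ C →
                            a —[ red ]— b → b —[ blue ]— d → d —[ red ]— e → a ≢ e → Adj G a e
    red-blue-red-adjacent a∈C b∈C d∈C e∈C ab bd de _ =
      let (i , b∈ , d∈) = blue-edge⇒same-B b∈C d∈C bd
          (_ , _ , _ , only) = meets-X-once i
      in contradiction (trans (only _ (proj₂ (red-edge⇒both-in-X a∈C b∈C ab)) b∈)
                              (sym (only _ (proj₁ (red-edge⇒both-in-X d∈C e∈C de)) d∈)))
                       (edge⇒≢ bd)

  shape-lawful : IsRBFence G C ⊎ IsRBCliqueStar G C → Lawful C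
  shape-lawful (inj₁ fence) = fence-lawful fence
  shape-lawful (inj₂ star) = star-lawful star

  module _ (lawful-around : ∀ v → ∃[ C ] (Lawful C × (∀ {u} → Reachable G v u → u ∈ C))) where

    private
      module Around (v : Fin n) where
        open Lawful (proj₁ (proj₂ (lawful-around v))) public

        inside : Reachable G v u → u ∈ proj₁ (lawful-around v)
        inside = proj₂ (proj₂ (lawful-around v))

    no-P3 : ∀ κ → ¬ ContainsInduced G (P3 κ κ)
    no-P3 κ (f , f-injective , f-colour) =
      contradiction (f-colour (# 0) (# 2))
        (edge⇒Adj (mono-trans (inside ε) (inside (f0~f1 ◅ ε)) (inside (f0~f1 ◅ f1~f2 ◅ ε))
                              (f-colour (# 0) (# 1)) (f-colour (# 1) (# 2)) ((λ ()) ∘ f-injective)))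
      where
      open Around (f (# 0))
      f0~f1 : Adj G (f (# 0)) (f (# 1))
      f0~f1 = edge⇒Adj (f-colour (# 0) (# 1))
      f1~f2 : Adj G (f (# 1)) (f (# 2))
      f1~f2 = edge⇒Adj (f-colour (# 1) (# 2))

    no-Tri : ∀ κ → ¬ ContainsInduced G (Tri κ κ (other κ))
    no-Tri κ (f , _ , f-colour) =
      other≢ κ (edge-colour-unique (f-colour (# 0) (# 2))
        (mono-trans (inside ε) (inside (f0~f1 ◅ ε)) (inside (f0~f1 ◅ f1~f2 ◅ ε))
                    (f-colour (# 0) (# 1)) (f-colour (# 1) (# 2)) (edge⇒≢ (f-colour (# 0) (# 2)))))
      where
      open Around (f (# 0))
      f0~f1 : Adj G (f (# 0)) (f (# 1))
      f0~f1 = edge⇒Adj (f-colour (# 0) (# 1))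
      f1~f2 : Adj G (f (# 1)) (f (# 2))
      f1~f2 = edge⇒Adj (f-colour (# 1) (# 2))

    no-P4 : ¬ ContainsInduced G P4rbr
    no-P4 (f , f-injective , f-colour) =
      red-blue-red-adjacent (inside ε) (inside (f0~f1 ◅ ε)) (inside (f0~f1 ◅ f1~f2 ◅ ε))
                            (inside (f0~f1 ◅ f1~f2 ◅ f2~f3 ◅ ε))
                            (f-colour (# 0) (# 1)) (f-colour (# 1) (# 2)) (f-colour (# 2) (# 3))
                            ((λ ()) ∘ f-injective) (f-colour (# 0) (# 3))
      where
      open Around (f (# 0))
      f0~f1 : Adj G (f (# 0)) (f (# 1))
      f0~f1 = edge⇒Adj (f-colour (# 0) (# 1))
      f1~f2 : Adj G (f (# 1)) (f (# 2))
      f1~f2 = edge⇒Adj (f-colour (# 1) (# 2))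
      f2~f3 : Adj G (f (# 2)) (f (# 3))
      f2~f3 = edge⇒Adj (f-colour (# 2) (# 3))

    lawful⇒InT : InT G
    lawful⇒InT = no-P3 blue , no-P3 red , no-Tri blue , no-Tri red , no-P4

  shaped⇒InT : (∀ C → IsComponent G C → IsRBFence G C ⊎ IsRBCliqueStar G C) → InT G
  shaped⇒InT shaped = lawful⇒InT λ v →
    reachable v , shape-lawful (shaped (reachable v) (v , λ _ → ∈-reachable v)) , from (∈-reachable v)
    where open StarClosure adj?

proposition23 : ∀ {n : ℕ} (G : BicoloredGraph n) →
    InT G ⇔ (∀ (C : Subset n) → IsComponent G C → IsRBFence G C ⊎ IsRBCliqueStar G C)
proposition23 G = mk⇔ (λ G∈𝒯 _ → Forward.component-shape G G∈𝒯) (Backward.shaped⇒InT G)
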